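{- Fix positive integers $k$ and $s$, and let $G$ be the $k$-fold strong product of the cycle $C_{2s+2}$. Then for every positive integer $s'$, $$c_{s',s'}(G)=\begin{cases}k+1, & \text{if } s'\le s,\\ 1, & \text{otherwise.}\end{cases}$$
   Context: All graphs are finite, undirected and reflexive. For a positive integer $t$, in the speed-$(t,t)$ Cops and Robbers game on a graph $G$, the cops first place themselves on vertices, then the robber places himself; play proceeds in rounds, each a cops' turn followed by a robber's turn. On the cops' turn each cop moves along a walk of length at most $t$ (possibly staying put); on the robber's turn he moves along a walk of length at most $t$ not passing through a cop-occupied vertex. The cops win if some cop occupies the robber's vertex; the robber wins if he evades forever. $c_{t,t}(G)$ is the minimum number of cops guaranteeing a win. The $k$-fold strong product of $C_{2s+2}$ has vertex set all $k$-tuples $(x_1,\dots,x_k)$ with $x_i\in\{0,\dots,2s+1\}$, two vertices being adjacent iff they differ by at most $1$ modulo $2s+2$ in every coordinate. -}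

module Defs where

open import Data.Nat using (ℕ; zero; suc; _+_; _*_; _≤_; _<_)
open import Data.Nat.DivMod using (_%_)
open import Data.Fin using (Fin; toℕ)
open import Data.Product using (Σ; ∃; _×_; _,_)
open import Data.Sum using (_⊎_)
open import Data.Unit using (⊤)
open import Relation.Nullary using (¬_)
open import Relation.Binary.PropositionalEquality using (_≡_)

-- Generic cops-and-robbers game at speed (t,t) on a graph with vertex
-- type V and (reflexive, symmetric) adjacency relation Adj.

module Game {V : Set} (Adj : V → V → Set) where

  data Walk (Ok : V → Set) : ℕ → V → V → Set where
    here : ∀ {u} → Ok u → Walk Ok zero u u
    step : ∀ {n u w v} → Ok u → Adj u w → Walk Ok n w v → Walk Ok (suc n) u v

  Cops : ℕ → Set
  Cops m = Fin m → V

  Occupied : ∀ {m} → Cops m → V → Set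
  Occupied {m} C v = Σ (Fin m) λ i → C i ≡ v

  CopMove : ℕ → V → V → Set
  CopMove t u v = Σ ℕ λ n → n ≤ t × Walk (λ _ → ⊤) n u v

  RobberMove : ∀ {m} → ℕ → Cops m → V → V → Set
  RobberMove t C r r' =
    Σ ℕ λ n → n ≤ t × Walk (λ v → ¬ Occupied C v) n r r'

  -- CopsWinFrom t C r : it is the cops' turn, cops at C, robber at r, and
  -- the cops have a strategy that captures the robber in finitely many
  -- rounds against every robber play.
  data CopsWinFrom (t : ℕ) {m : ℕ} (C : Cops m) (r : V) : Set where
    move : (C' : Cops m) → (∀ i → CopMove t (C i) (C' i)) →
           (Occupied C' r ⊎
            (∀ r' → RobberMove t C' r r' → CopsWinFrom t C' r')) →
           CopsWinFrom t C r

  CopsWin : ℕ → ℕ → Set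
  CopsWin t m = Σ (Cops m) λ C₀ → ∀ r → Occupied C₀ r ⊎ CopsWinFrom t C₀ r

  CopNumberIs : ℕ → ℕ → Set
  CopNumberIs t c = CopsWin t c × (∀ m → m < c → ¬ CopsWin t m)

CycleAdj : (n : ℕ) → Fin (suc (suc n)) → Fin (suc (suc n)) → Set
CycleAdj n a b =
  toℕ b ≡ toℕ a ⊎
  (toℕ b ≡ suc (toℕ a) % suc (suc n) ⊎ toℕ a ≡ suc (toℕ b) % suc (suc n))

SPVertex : ℕ → ℕ → Set
SPVertex k s = Fin k → Fin (suc (suc (2 * s)))

SPAdj : (k s : ℕ) → SPVertex k s → SPVertex k s → Set
SPAdj k s x y = ∀ i → CycleAdj (2 * s) (x i) (y i)

{-# OPTIONS --safe #-}
module Submission where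

open import Defs
open import Data.Bool using (Bool; true; false; not)
open import Data.Empty using (⊥-elim)
open import Data.Fin using (Fin; zero; suc; toℕ; fromℕ; fromℕ<; inject₁; inject≤)
import Data.Fin.Properties as Fin
open import Data.Nat using (ℕ; zero; suc; _+_; _*_; _∸_; _≤_; _<_; _⊓_; z≤n; s≤s; s≤s⁻¹; _≤?_; _<?_)
open import Data.Nat.DivMod
open import Data.Nat.Induction using (<-wellFounded)
open import Data.Nat.Properties
open import Data.Nat.Tactic.RingSolver using (solve-∀)
open import Algebra.Properties.Monoid.Sum +-0-monoid using (sum; sum-cong-≗)
open import Data.Product using (Σ; ∃; _×_; _,_; proj₁; proj₂)
open import Data.Product.Relation.Binary.Lex.Strict using (×-Lex; ×-wellFounded)
open import Data.Sum using (_⊎_; inj₁; inj₂)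
open import Data.Unit using (tt)
open import Data.Vec.Functional using (updateAt)
open import Data.Vec.Functional.Properties using (updateAt-updates; updateAt-minimal)
open import Function using (_∘_; const)
open import Induction.WellFounded using (Acc; acc)
open import Level using (Level)
open import Relation.Binary.PropositionalEquality
open import Relation.Nullary using (Dec; yes; no; ¬_; does)
open import Relation.Nullary.Decidable using (_⊎-dec_; dec-false; dec-true)
open import Relation.Unary using (Pred; Decidable)

-- Positions on the cycle C_N, N = 2s + 2, are compared through clockwise arcs.
--
-- If s' > s, any two points of C_N are at distance at most s + 1 ≤ s', so a
-- single cop reaches the robber in every coordinate at once.
--
-- If s' ≤ s, the robber beats m ≤ k cops: every cop owns a coordinate, and in
-- each coordinate the robber stands antipodally to its owner and copies the
-- owner's moves. A cop moves at most s < s + 1 per turn, so it never meets the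
-- robber's path.
--
-- Conversely k + 1 cops win at any speed. The level of a cop is the number of
-- leading coordinates in which it is within s' of the robber; every cop copies
-- the robber there, so levels never drop. A cop of level k captures at once.
-- Otherwise, by pigeonhole, two cops i and j have the same level e; moving i
-- clockwise and j counterclockwise in coordinate e shrinks the clockwise gap
-- from i through the robber to j, and the robber can only leave that gap by
-- raising a level. So (sum of levels, gap) improves lexicographically until
-- capture.

module _ {ℓ : Level} where

  prefixLength : ∀ {k} {P : Pred (Fin k) ℓ} → Decidable P → ℕ
  prefixLength {zero} P? = 0
  prefixLength {suc k} P? with P? zero
  ... | yes _ = suc (prefixLength (P? ∘ suc))
  ... | no _ = 0

  prefixLength≤ : ∀ {k} {P : Pred (Fin k) ℓ} (P? : Decidable P) → prefixLength P? ≤ k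
  prefixLength≤ {zero} P? = z≤n
  prefixLength≤ {suc k} P? with P? zero
  ... | yes _ = s≤s (prefixLength≤ (P? ∘ suc))
  ... | no _ = z≤n

  prefixLength-holds : ∀ {k} {P : Pred (Fin k) ℓ} (P? : Decidable P) i →
                       toℕ i < prefixLength P? → P i
  prefixLength-holds {suc k} P? i lt with P? zero
  prefixLength-holds {suc k} P? zero lt | yes p = p
  prefixLength-holds {suc k} P? (suc i) lt | yes _ = prefixLength-holds (P? ∘ suc) i (s≤s⁻¹ lt)

  prefixLength-fails : ∀ {k} {P : Pred (Fin k) ℓ} (P? : Decidable P) i →
                       toℕ i ≡ prefixLength P? → ¬ P i
  prefixLength-fails {suc k} P? i eq with P? zero
  prefixLength-fails {suc k} P? (suc i) eq | yes _ = prefixLength-fails (P? ∘ suc) i (suc-injective eq)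
  prefixLength-fails {suc k} P? zero eq | no ¬p = ¬p

  prefixLength-mono : ∀ {k} {P Q : Pred (Fin k) ℓ} (P? : Decidable P) (Q? : Decidable Q) →
                      (∀ i → toℕ i < prefixLength P? → Q i) → prefixLength P? ≤ prefixLength Q?
  prefixLength-mono {zero} P? Q? PQ = z≤n
  prefixLength-mono {suc k} P? Q? PQ with P? zero | Q? zero
  ... | no _ | _ = z≤n
  ... | yes _ | no ¬q = ⊥-elim (¬q (PQ zero (s≤s z≤n)))
  ... | yes _ | yes _ = s≤s (prefixLength-mono (P? ∘ suc) (Q? ∘ suc) (λ i lt → PQ (suc i) (s≤s lt)))

sum-mono-≤ : ∀ {m} {f g : Fin m → ℕ} → (∀ i → f i ≤ g i) → sum f ≤ sum g
sum-mono-≤ {zero} f≤g = z≤n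
sum-mono-≤ {suc m} f≤g = +-mono-≤ (f≤g zero) (sum-mono-≤ (f≤g ∘ suc))

sum-mono-< : ∀ {m} {f g : Fin m → ℕ} → (∀ i → f i ≤ g i) → ∀ i → f i < g i → sum f < sum g
sum-mono-< f≤g zero lt = +-mono-<-≤ lt (sum-mono-≤ (f≤g ∘ suc))
sum-mono-< f≤g (suc i) lt = +-mono-≤-< (f≤g zero) (sum-mono-< (f≤g ∘ suc) i lt)

module GameFacts {V : Set} (Adj : V → V → Set) where
  open Game Adj

  walk-along : ∀ {Ok} (f : ℕ → V) n {v} → (∀ p → p ≤ n → Ok (f p)) →
               (∀ p → Adj (f p) (f (suc p))) → Adj (f n) v → Ok v → Walk Ok (suc n) (f 0) v
  walk-along f zero ok adj last okv = step (ok 0 z≤n) last (here okv)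
  walk-along f (suc n) ok adj last okv =
    step (ok 0 z≤n) (adj 0) (walk-along (f ∘ suc) n (λ p p≤n → ok (suc p) (s≤s p≤n)) (adj ∘ suc) last okv)

  stay : ∀ t {u} → CopMove t u u
  stay t = 0 , z≤n , here tt

  capture : ∀ {t m} (C : Cops m) r c → CopMove t (C c) r → CopsWinFrom t C r
  capture {t} C r c c→r = move (updateAt C c (const r)) moves (inj₁ (c , updateAt-updates c C))
    where
      moves : ∀ c' → CopMove t (C c') (updateAt C c (const r) c')
      moves c' with c' Fin.≟ c
      ... | yes refl = subst (CopMove t (C c)) (sym (updateAt-updates c C)) c→r
      ... | no c'≢c = subst (CopMove t (C c')) (sym (updateAt-minimal c' c C c'≢c)) (stay t)

  no-cops-lose : ∀ {t} → V → ¬ CopsWin t 0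
  no-cops-lose {t} v (C₀ , win) with win v
  ... | inj₁ (() , _)
  ... | inj₂ w = evade w
    where
      evade : ∀ {C : Cops 0} {r} → ¬ CopsWinFrom t C r
      evade (move C' _ (inj₁ (() , _)))
      evade {r = r} (move C' _ (inj₂ next)) = evade (next r (0 , z≤n , here λ { (() , _) }))

module Cycle (n : ℕ) where

  N : ℕ
  N = suc (suc n)

  -- Clockwise means increasing toℕ. Opaque, so that arc a b is not unfolded
  -- into a mod-helper term and its arguments stay inferable.
  opaque
    arc : Fin N → Fin N → ℕ
    arc a b = (toℕ b + (N ∸ toℕ a)) % N

  private
    toℕ+[N∸toℕ]≡N : ∀ (a : Fin N) → toℕ a + (N ∸ toℕ a) ≡ N
    toℕ+[N∸toℕ]≡N a = m+[n∸m]≡n (<⇒≤ (Fin.toℕ<n a))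

    [m%N+n]%N≡[m+n]%N : ∀ x y → (x % N + y) % N ≡ (x + y) % N
    [m%N+n]%N≡[m+n]%N x y = begin
      (x % N + y) % N          ≡⟨ %-distribˡ-+ (x % N) y N ⟩
      (x % N % N + y % N) % N  ≡⟨ cong (λ z → (z + y % N) % N) (m%n%n≡m%n x N) ⟩
      (x % N + y % N) % N      ≡⟨ %-distribˡ-+ x y N ⟨
      (x + y) % N              ∎
      where open ≡-Reasoning

    [m+n%N]%N≡[m+n]%N : ∀ x y → (x + y % N) % N ≡ (x + y) % N
    [m+n%N]%N≡[m+n]%N x y = begin
      (x + y % N) % N  ≡⟨ cong (_% N) (+-comm x (y % N)) ⟩
      (y % N + x) % N  ≡⟨ [m%N+n]%N≡[m+n]%N y x ⟩
      (y + x) % N      ≡⟨ cong (_% N) (+-comm y x) ⟩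
      (x + y) % N      ∎
      where open ≡-Reasoning

    mod-split : ∀ x y {z} → x + y < N + N → (x + y) % N ≡ z → x + y ≡ z ⊎ x + y ≡ N + z
    mod-split x y {z} lt eq with x + y <? N
    ... | yes x+y<N = inj₁ (trans (sym (m<n⇒m%n≡m x+y<N)) eq)
    ... | no x+y≮N = inj₂ (begin
      x + y            ≡⟨ m+[n∸m]≡n N≤x+y ⟨
      N + (x + y ∸ N)  ≡⟨ cong (N +_) excess≡z ⟩
      N + z            ∎)
      where
        open ≡-Reasoning
        N≤x+y = ≮⇒≥ x+y≮N
        excess≡z : x + y ∸ N ≡ z
        excess≡z = begin
          x + y ∸ N        ≡⟨ m<n⇒m%n≡m (m<n+o⇒m∸n<o (x + y) N lt) ⟨
          (x + y ∸ N) % N  ≡⟨ m≤n⇒[n∸m]%m≡n%m N≤x+y ⟩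
          (x + y) % N      ≡⟨ eq ⟩
          z                ∎

  opaque
    unfolding arc

    arc<N : ∀ a b → arc a b < N
    arc<N a b = m%n<n (toℕ b + (N ∸ toℕ a)) N

    arc-refl : ∀ a → arc a a ≡ 0
    arc-refl a = trans (cong (_% N) (toℕ+[N∸toℕ]≡N a)) (n%n≡0 N)

    arc-%-trans : ∀ a b c → arc a c ≡ (arc a b + arc b c) % N
    arc-%-trans a b c = sym (begin
      (arc a b + arc b c) % N
        ≡⟨ [m%N+n]%N≡[m+n]%N (toℕ b + (N ∸ toℕ a)) (arc b c) ⟩
      (toℕ b + (N ∸ toℕ a) + arc b c) % N
        ≡⟨ [m+n%N]%N≡[m+n]%N (toℕ b + (N ∸ toℕ a)) (toℕ c + (N ∸ toℕ b)) ⟩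
      (toℕ b + (N ∸ toℕ a) + (toℕ c + (N ∸ toℕ b))) % N
        ≡⟨ cong (_% N) (rearrange (toℕ b) (N ∸ toℕ a) (toℕ c) (N ∸ toℕ b)) ⟩
      (toℕ c + (N ∸ toℕ a) + (toℕ b + (N ∸ toℕ b))) % N
        ≡⟨ cong (λ z → (toℕ c + (N ∸ toℕ a) + z) % N) (toℕ+[N∸toℕ]≡N b) ⟩
      (toℕ c + (N ∸ toℕ a) + N) % N
        ≡⟨ [m+n]%n≡m%n (toℕ c + (N ∸ toℕ a)) N ⟩
      arc a c ∎)
      where
        open ≡-Reasoning
        rearrange : ∀ w x y z → w + x + (y + z) ≡ y + x + (w + z)
        rearrange = solve-∀

    arc≡0⇒≡ : ∀ {a b} → arc a b ≡ 0 → a ≡ b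
    arc≡0⇒≡ {a} {b} eq
      with mod-split (toℕ b) (N ∸ toℕ a) (+-mono-<-≤ (Fin.toℕ<n b) (m∸n≤m N (toℕ a))) eq
    ... | inj₁ sum≡0 = ⊥-elim (<⇒≱ (Fin.toℕ<n a) (m∸n≡0⇒m≤n (m+n≡0⇒n≡0 (toℕ b) sum≡0)))
    ... | inj₂ sum≡N = sym (Fin.toℕ-injective (+-cancelʳ-≡ (N ∸ toℕ a) (toℕ b) (toℕ a)
                        (trans sum≡N (trans (+-identityʳ N) (sym (toℕ+[N∸toℕ]≡N a))))))

  -- Going clockwise from a to b and on to c either stays within one turn or
  -- passes a once more.
  Between Wraps : Fin N → Fin N → Fin N → Set
  Between a b c = arc a b + arc b c ≡ arc a c
  Wraps a b c = arc a b + arc b c ≡ N + arc a c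

  between⊎wraps : ∀ a b c → Between a b c ⊎ Wraps a b c
  between⊎wraps a b c = mod-split (arc a b) (arc b c) (+-mono-< (arc<N a b) (arc<N b c)) (sym (arc-%-trans a b c))

  arc-flip : ∀ a b → arc a b + arc b a ≡ 0 ⊎ arc a b + arc b a ≡ N
  arc-flip a b with between⊎wraps a b a
  ... | inj₁ between = inj₁ (trans between (arc-refl a))
  ... | inj₂ wraps = inj₂ (trans wraps (trans (cong (N +_) (arc-refl a)) (+-identityʳ N)))

  between⇒arc≤ˡ : ∀ {a b c} → Between a b c → arc a b ≤ arc a c
  between⇒arc≤ˡ {a} {b} {c} between = subst (arc a b ≤_) between (m≤m+n (arc a b) (arc b c))

  between⇒arc≤ʳ : ∀ {a b c} → Between a b c → arc b c ≤ arc a c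
  between⇒arc≤ʳ {a} {b} {c} between = subst (arc b c ≤_) between (m≤n+m (arc b c) (arc a b))

  wraps⇒arc<ˡ : ∀ {a b c} → Wraps a b c → arc a c < arc a b
  wraps⇒arc<ˡ {a} {b} {c} wraps = +-cancelˡ-< N (arc a c) (arc a b) (begin-strict
    N + arc a c      ≡⟨ wraps ⟨
    arc a b + arc b c <⟨ +-monoʳ-< (arc a b) (arc<N b c) ⟩
    arc a b + N      ≡⟨ +-comm (arc a b) N ⟩
    N + arc a b      ∎)
    where open ≤-Reasoning

  wraps⇒arc<ʳ : ∀ {a b c} → Wraps a b c → arc a c < arc b c
  wraps⇒arc<ʳ {a} {b} {c} wraps = +-cancelˡ-< N (arc a c) (arc b c) (begin-strict
    N + arc a c       ≡⟨ wraps ⟨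
    arc a b + arc b c <⟨ +-monoˡ-< (arc b c) (arc<N a b) ⟩
    N + arc b c       ∎)
    where open ≤-Reasoning

  arc≤⇒betweenˡ : ∀ {a b c} → arc a b ≤ arc a c → Between a b c
  arc≤⇒betweenˡ {a} {b} {c} ab≤ac with between⊎wraps a b c
  ... | inj₁ between = between
  ... | inj₂ wraps = ⊥-elim (<⇒≱ (wraps⇒arc<ˡ wraps) ab≤ac)

  arc≤⇒betweenʳ : ∀ {a b c} → arc b c ≤ arc a c → Between a b c
  arc≤⇒betweenʳ {a} {b} {c} bc≤ac with between⊎wraps a b c
  ... | inj₁ between = between
  ... | inj₂ wraps = ⊥-elim (<⇒≱ (wraps⇒arc<ʳ wraps) bc≤ac)

  wraps⇒betweenʳ : ∀ {a b c} → Wraps a b c → Between a c b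
  wraps⇒betweenʳ wraps = arc≤⇒betweenˡ (<⇒≤ (wraps⇒arc<ˡ wraps))

  wraps⇒betweenˡ : ∀ {a b c} → Wraps a b c → Between b a c
  wraps⇒betweenˡ wraps = arc≤⇒betweenʳ (<⇒≤ (wraps⇒arc<ʳ wraps))

  arc-injectiveʳ : ∀ {a x y} → arc a x ≡ arc a y → x ≡ y
  arc-injectiveʳ {a} {x} {y} eq = arc≡0⇒≡ (+-cancelˡ-≡ (arc a x) (arc x y) 0
    (trans (arc≤⇒betweenˡ (≤-reflexive eq)) (trans (sym eq) (sym (+-identityʳ (arc a x))))))

  arc-injectiveˡ : ∀ {a x y} → arc x a ≡ arc y a → x ≡ y
  arc-injectiveˡ {a} {x} {y} eq = arc≡0⇒≡ (+-cancelʳ-≡ (arc y a) (arc x y) 0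
    (trans (arc≤⇒betweenʳ (≤-reflexive (sym eq))) eq))

  next prev : Fin N → Fin N
  next a = suc (toℕ a) mod N
  prev zero = fromℕ (suc n)
  prev (suc a) = inject₁ a

  suc-toℕ-prev : ∀ a → suc (toℕ (prev a)) % N ≡ toℕ a
  suc-toℕ-prev zero = trans (cong (λ z → suc z % N) (Fin.toℕ-fromℕ (suc n))) (n%n≡0 N)
  suc-toℕ-prev (suc a) = trans (cong (λ z → suc z % N) (Fin.toℕ-inject₁ a)) (m<n⇒m%n≡m (Fin.toℕ<n (suc a)))

  next-prev : ∀ a → next (prev a) ≡ a
  next-prev a = Fin.toℕ-injective (trans (Fin.toℕ-fromℕ< _) (suc-toℕ-prev a))

  opaque
    unfolding arc

    arc-next : ∀ a → arc a (next a) ≡ 1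
    arc-next a = begin
      (toℕ (next a) + (N ∸ toℕ a)) % N
        ≡⟨ cong (λ z → (z + (N ∸ toℕ a)) % N) (Fin.toℕ-fromℕ< (m%n<n (suc (toℕ a)) N)) ⟩
      (suc (toℕ a) % N + (N ∸ toℕ a)) % N
        ≡⟨ [m%N+n]%N≡[m+n]%N (suc (toℕ a)) (N ∸ toℕ a) ⟩
      suc (toℕ a + (N ∸ toℕ a)) % N
        ≡⟨ cong (λ z → suc z % N) (toℕ+[N∸toℕ]≡N a) ⟩
      suc N % N
        ≡⟨ [m+n]%n≡m%n 1 N ⟩
      1 ∎
      where open ≡-Reasoning

  arc-prev : ∀ a → arc (prev a) a ≡ 1
  arc-prev a = subst (λ b → arc (prev a) b ≡ 1) (next-prev a) (arc-next (prev a))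

  prev-next : ∀ a → prev (next a) ≡ a
  prev-next a = arc-injectiveˡ (trans (arc-prev (next a)) (sym (arc-next a)))

  neighbour : Bool → Fin N → Fin N
  neighbour true = next
  neighbour false = prev

  neighbour-inverse : ∀ d a → neighbour d (neighbour (not d) a) ≡ a
  neighbour-inverse true = next-prev
  neighbour-inverse false = prev-next

  neighbour-comm : ∀ d d' a → neighbour d (neighbour d' a) ≡ neighbour d' (neighbour d a)
  neighbour-comm true true a = refl
  neighbour-comm false false a = refl
  neighbour-comm true false a = trans (neighbour-inverse true a) (sym (neighbour-inverse false a))
  neighbour-comm false true a = trans (neighbour-inverse false a) (sym (neighbour-inverse true a))

  rotate : Bool → ℕ → Fin N → Fin N
  rotate d zero a = a
  rotate d (suc q) a = rotate d q (neighbour d a)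

  rotate-+ : ∀ d p q a → rotate d (p + q) a ≡ rotate d q (rotate d p a)
  rotate-+ d zero q a = refl
  rotate-+ d (suc p) q a = rotate-+ d p q (neighbour d a)

  rotate-neighbour-comm : ∀ d d' q a → rotate d q (neighbour d' a) ≡ neighbour d' (rotate d q a)
  rotate-neighbour-comm d d' zero a = refl
  rotate-neighbour-comm d d' (suc q) a =
    trans (cong (rotate d q) (neighbour-comm d d' a)) (rotate-neighbour-comm d d' q (neighbour d a))

  rotate-comm : ∀ d d' p q a → rotate d p (rotate d' q a) ≡ rotate d' q (rotate d p a)
  rotate-comm d d' zero q a = refl
  rotate-comm d d' (suc p) q a =
    trans (cong (rotate d p) (sym (rotate-neighbour-comm d' d q a))) (rotate-comm d d' p q (neighbour d a))

  arc-rotate-cw : ∀ q a → arc a (rotate true q a) ≡ q % N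
  arc-rotate-cw zero a = arc-refl a
  arc-rotate-cw (suc q) a = begin
    arc a (rotate true q (next a))
      ≡⟨ arc-%-trans a (next a) _ ⟩
    (arc a (next a) + arc (next a) (rotate true q (next a))) % N
      ≡⟨ cong₂ (λ u v → (u + v) % N) (arc-next a) (arc-rotate-cw q (next a)) ⟩
    (1 + q % N) % N
      ≡⟨ [m+n%N]%N≡[m+n]%N 1 q ⟩
    suc q % N ∎
    where open ≡-Reasoning

  arc-rotate-ccw : ∀ q a → arc (rotate false q a) a ≡ q % N
  arc-rotate-ccw zero a = arc-refl a
  arc-rotate-ccw (suc q) a = begin
    arc (rotate false q (prev a)) a
      ≡⟨ arc-%-trans _ (prev a) a ⟩
    (arc (rotate false q (prev a)) (prev a) + arc (prev a) a) % N
      ≡⟨ cong₂ (λ u v → (u + v) % N) (arc-rotate-ccw q (prev a)) (arc-prev a) ⟩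
    (q % N + 1) % N
      ≡⟨ [m%N+n]%N≡[m+n]%N q 1 ⟩
    (q + 1) % N
      ≡⟨ cong (_% N) (+-comm q 1) ⟩
    suc q % N ∎
    where open ≡-Reasoning

  Within : ℕ → Fin N → Fin N → Set
  Within t a b = arc a b ≤ t ⊎ arc b a ≤ t

  within? : ∀ t a b → Dec (Within t a b)
  within? t a b = (arc a b ≤? t) ⊎-dec (arc b a ≤? t)

  within-mono : ∀ {t u a b} → t ≤ u → Within t a b → Within u a b
  within-mono t≤u (inj₁ ab≤t) = inj₁ (≤-trans ab≤t t≤u)
  within-mono t≤u (inj₂ ba≤t) = inj₂ (≤-trans ba≤t t≤u)

  ¬within⇒< : ∀ {t a b} → ¬ Within t a b → t < arc a b × t < arc b a
  ¬within⇒< ¬within = ≰⇒> (¬within ∘ inj₁) , ≰⇒> (¬within ∘ inj₂)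

  record Reach (t : ℕ) (a b : Fin N) : Set where
    constructor reach
    field
      clockwise : Bool
      steps : ℕ
      steps≤ : steps ≤ t
      arrives : rotate clockwise steps a ≡ b

  reach-mono : ∀ {t u a b} → t ≤ u → Reach t a b → Reach u a b
  reach-mono t≤u (reach d q q≤t arrives) = reach d q (≤-trans q≤t t≤u) arrives

  reach⇒within : ∀ {t a b} → Reach t a b → Within t a b
  reach⇒within {a = a} (reach true q q≤t refl) =
    inj₁ (≤-trans (≤-reflexive (arc-rotate-cw q a)) (≤-trans (m%n≤m q N) q≤t))
  reach⇒within {a = a} (reach false q q≤t refl) =
    inj₂ (≤-trans (≤-reflexive (arc-rotate-ccw q a)) (≤-trans (m%n≤m q N) q≤t))

  within⇒reach : ∀ {t a b} → Within t a b → Reach t a b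
  within⇒reach {a = a} {b} (inj₁ ab≤t) =
    reach true (arc a b) ab≤t (arc-injectiveʳ (trans (arc-rotate-cw (arc a b) a) (m<n⇒m%n≡m (arc<N a b))))
  within⇒reach {a = a} {b} (inj₂ ba≤t) =
    reach false (arc b a) ba≤t (arc-injectiveˡ (trans (arc-rotate-ccw (arc b a) a) (m<n⇒m%n≡m (arc<N b a))))

  adjacent-neighbour : ∀ d a → CycleAdj n a (neighbour d a)
  adjacent-neighbour true a = inj₂ (inj₁ (Fin.toℕ-fromℕ< (m%n<n (suc (toℕ a)) N)))
  adjacent-neighbour false a = inj₂ (inj₂ (sym (suc-toℕ-prev a)))

  adjacent-cases : ∀ {a b} → CycleAdj n a b → b ≡ a ⊎ ∃ λ d → b ≡ neighbour d a
  adjacent-cases (inj₁ eq) = inj₁ (Fin.toℕ-injective eq)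
  adjacent-cases (inj₂ (inj₁ eq)) = inj₂ (true , Fin.toℕ-injective (trans eq (sym (Fin.toℕ-fromℕ< _))))
  adjacent-cases {a} {b} (inj₂ (inj₂ eq)) =
    inj₂ (false , trans (sym (prev-next b)) (cong prev (Fin.toℕ-injective (trans (Fin.toℕ-fromℕ< _) (sym eq)))))

  adjacent-rotate-⊓ : ∀ d p q a → CycleAdj n (rotate d (p ⊓ q) a) (rotate d (suc p ⊓ q) a)
  adjacent-rotate-⊓ d zero zero a = inj₁ refl
  adjacent-rotate-⊓ d (suc p) zero a = inj₁ refl
  adjacent-rotate-⊓ d zero (suc q) a = adjacent-neighbour d a
  adjacent-rotate-⊓ d (suc p) (suc q) a = adjacent-rotate-⊓ d p q (neighbour d a)

  reach-after-neighbour : ∀ {t c} d a → Reach t (neighbour d a) c → Reach (suc t) a c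
  reach-after-neighbour d a (reach d' zero _ arrives) = reach d 1 (s≤s z≤n) arrives
  reach-after-neighbour true a (reach true (suc q) q<t arrives) = reach true (suc (suc q)) (s≤s q<t) arrives
  reach-after-neighbour false a (reach false (suc q) q<t arrives) = reach false (suc (suc q)) (s≤s q<t) arrives
  reach-after-neighbour true a (reach false (suc q) q<t arrives) =
    reach false q (m≤n⇒m≤1+n (<⇒≤ q<t)) (trans (cong (rotate false q) (sym (neighbour-inverse false a))) arrives)
  reach-after-neighbour false a (reach true (suc q) q<t arrives) =
    reach true q (m≤n⇒m≤1+n (<⇒≤ q<t)) (trans (cong (rotate true q) (sym (neighbour-inverse true a))) arrives)

  reach-after-adjacent : ∀ {t a b c} → CycleAdj n a b → Reach t b c → Reach (suc t) a c
  reach-after-adjacent adj R with adjacent-cases adj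
  ... | inj₁ refl = reach-mono (n≤1+n _) R
  ... | inj₂ (d , refl) = reach-after-neighbour d _ R

  arc-rotate-cw-toward : ∀ {t a x} → t ≤ arc a x → t + arc (rotate true t a) x ≡ arc a x
  arc-rotate-cw-toward {t} {a} {x} t≤ax =
    trans (cong (_+ arc (rotate true t a) x) (sym arc≡t)) (arc≤⇒betweenˡ (subst (_≤ arc a x) (sym arc≡t) t≤ax))
    where
      arc≡t : arc a (rotate true t a) ≡ t
      arc≡t = trans (arc-rotate-cw t a) (m<n⇒m%n≡m (≤-<-trans t≤ax (arc<N a x)))

  arc-rotate-ccw-toward : ∀ {t x b} → t ≤ arc x b → arc x (rotate false t b) + t ≡ arc x b
  arc-rotate-ccw-toward {t} {x} {b} t≤xb =
    trans (cong (arc x (rotate false t b) +_) (sym arc≡t)) (arc≤⇒betweenʳ (subst (_≤ arc x b) (sym arc≡t) t≤xb))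
    where
      arc≡t : arc (rotate false t b) b ≡ t
      arc≡t = trans (arc-rotate-ccw t b) (m<n⇒m%n≡m (≤-<-trans t≤xb (arc<N x b)))

  -- Moving at most t, x cannot pass p or q without ending within t of it.
  arc-sum-preserved : ∀ {t p q x x'} → Within t x x' → ¬ Within t p x' → ¬ Within t q x' →
                      arc p x' + arc x' q ≡ arc p x + arc x q
  arc-sum-preserved {t} {p} {q} {x} {x'} (inj₁ xx'≤t) ¬px' ¬qx' = begin
    arc p x' + arc x' q               ≡⟨ cong (_+ arc x' q) p-x-x' ⟨
    arc p x + arc x x' + arc x' q     ≡⟨ +-assoc (arc p x) (arc x x') (arc x' q) ⟩
    arc p x + (arc x x' + arc x' q)   ≡⟨ cong (arc p x +_) x-x'-q ⟩
    arc p x + arc x q                 ∎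
    where
      open ≡-Reasoning
      p-x-x' : Between p x x'
      p-x-x' with between⊎wraps p x x'
      ... | inj₁ between = between
      ... | inj₂ wraps =
        ⊥-elim (<⇒≱ (wraps⇒arc<ʳ wraps) (<⇒≤ (≤-<-trans xx'≤t (proj₁ (¬within⇒< ¬px')))))
      x-x'-q : Between x x' q
      x-x'-q with between⊎wraps x x' q
      ... | inj₁ between = between
      ... | inj₂ wraps =
        ⊥-elim (<⇒≱ (proj₁ (¬within⇒< ¬qx')) (≤-trans (between⇒arc≤ʳ (wraps⇒betweenʳ wraps)) xx'≤t))
  arc-sum-preserved {t} {p} {q} {x} {x'} (inj₂ x'x≤t) ¬px' ¬qx' = begin
    arc p x' + arc x' q               ≡⟨ cong (arc p x' +_) x'-x-q ⟨
    arc p x' + (arc x' x + arc x q)   ≡⟨ +-assoc (arc p x') (arc x' x) (arc x q) ⟨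
    arc p x' + arc x' x + arc x q     ≡⟨ cong (_+ arc x q) p-x'-x ⟩
    arc p x + arc x q                 ∎
    where
      open ≡-Reasoning
      p-x'-x : Between p x' x
      p-x'-x with between⊎wraps p x' x
      ... | inj₁ between = between
      ... | inj₂ wraps =
        ⊥-elim (<⇒≱ (proj₂ (¬within⇒< ¬px')) (≤-trans (between⇒arc≤ˡ (wraps⇒betweenˡ wraps)) x'x≤t))
      x'-x-q : Between x' x q
      x'-x-q with between⊎wraps x' x q
      ... | inj₁ between = between
      ... | inj₂ wraps =
        ⊥-elim (<⇒≱ (wraps⇒arc<ˡ wraps) (<⇒≤ (≤-<-trans x'x≤t (proj₂ (¬within⇒< ¬qx')))))

module EvenCycle (s : ℕ) where
  open Cycle (2 * s)

  N≡2[1+s] : N ≡ suc s + suc s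
  N≡2[1+s] = lemma s
    where
      lemma : ∀ s → suc (suc (2 * s)) ≡ suc s + suc s
      lemma = solve-∀

  antipode : Fin N → Fin N
  antipode = rotate true (suc s)

  arc-antipode : ∀ a → arc a (antipode a) ≡ suc s
  arc-antipode a = trans (arc-rotate-cw (suc s) a)
    (m<n⇒m%n≡m (subst (suc s <_) (sym N≡2[1+s]) (m<m+n (suc s) (s≤s z≤n))))

  arc-antipode-back : ∀ a → arc (antipode a) a ≡ suc s
  arc-antipode-back a with arc-flip a (antipode a)
  ... | inj₁ sum≡0 = ⊥-elim (0≢1+n (trans (sym (m+n≡0⇒m≡0 _ sum≡0)) (arc-antipode a)))
  ... | inj₂ sum≡N = +-cancelˡ-≡ (suc s) _ _
                      (trans (cong (_+ arc (antipode a) a) (sym (arc-antipode a))) (trans sum≡N N≡2[1+s]))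

  ¬within-antipode : ∀ a → ¬ Within s a (antipode a)
  ¬within-antipode a (inj₁ a→a'≤s) = 1+n≰n (subst (_≤ s) (arc-antipode a) a→a'≤s)
  ¬within-antipode a (inj₂ a'→a≤s) = 1+n≰n (subst (_≤ s) (arc-antipode-back a) a'→a≤s)

  rotate-≢-antipode : ∀ {q} d a → q ≤ s → rotate d q a ≢ antipode a
  rotate-≢-antipode d a q≤s eq =
    ¬within-antipode a (subst (Within s a) eq (reach⇒within (reach d _ q≤s refl)))

  mirror : ∀ {t a a'} → Reach t a a' → Reach t (antipode a) (antipode a')
  mirror {a = a} R = reach (clockwise R) (steps R) (steps≤ R)
    (trans (rotate-comm (clockwise R) true (steps R) (suc s) a) (cong antipode (arrives R)))
    where open Reach

  -- At time p the mirrored point is the antipode of the point p steps along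
  -- R, which is within s of a'.
  mirror-never-meets : ∀ {t a a'} → t ≤ s → (R : Reach t a a') → ∀ p →
                       a' ≢ rotate (Reach.clockwise R) (p ⊓ Reach.steps R) (antipode a)
  mirror-never-meets {a = a} t≤s (reach d q q≤t refl) p met =
    rotate-≢-antipode d (rotate d (p ⊓ q) a) (≤-trans (m∸n≤m q (p ⊓ q)) (≤-trans q≤t t≤s)) (begin
      rotate d (q ∸ p ⊓ q) (rotate d (p ⊓ q) a)  ≡⟨ rotate-+ d (p ⊓ q) (q ∸ p ⊓ q) a ⟨
      rotate d (p ⊓ q + (q ∸ p ⊓ q)) a          ≡⟨ cong (λ z → rotate d z a) (m+[n∸m]≡n (m⊓n≤n p q)) ⟩
      rotate d q a                               ≡⟨ met ⟩
      rotate d (p ⊓ q) (antipode a)              ≡⟨ rotate-comm d true (p ⊓ q) (suc s) a ⟩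
      antipode (rotate d (p ⊓ q) a)              ∎)
    where open ≡-Reasoning

  all-within : ∀ a b → Within (suc s) a b
  all-within a b with arc a b ≤? suc s
  ... | yes ab≤1+s = inj₁ ab≤1+s
  ... | no ab≰1+s with arc-flip a b
  ...   | inj₁ sum≡0 = ⊥-elim (ab≰1+s (subst (_≤ suc s) (sym (m+n≡0⇒m≡0 _ sum≡0)) z≤n))
  ...   | inj₂ sum≡N = inj₂ (<⇒≤ (+-cancelˡ-< (arc a b) (arc b a) (suc s) (begin-strict
          arc a b + arc b a  ≡⟨ trans sum≡N N≡2[1+s] ⟩
          suc s + suc s      <⟨ +-monoˡ-< (suc s) (≰⇒> ab≰1+s) ⟩
          arc a b + suc s    ∎)))
    where open ≤-Reasoning

module StrongProduct (k s : ℕ) where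
  open Cycle (2 * s) public
  open Game (SPAdj k s) public
  open GameFacts (SPAdj k s) public

  walk⇒reach : ∀ {Ok len u v} → Walk Ok len u v → ∀ i → Reach len (u i) (v i)
  walk⇒reach (here _) i = reach true 0 z≤n refl
  walk⇒reach (step _ adj w) i = reach-after-adjacent (adj i) (walk⇒reach w i)

  move⇒reach : ∀ {Ok t u v} → (Σ ℕ λ len → len ≤ t × Walk Ok len u v) → ∀ i → Reach t (u i) (v i)
  move⇒reach (_ , len≤t , w) i = reach-mono len≤t (walk⇒reach w i)

  module _ {t' : ℕ} {u v : SPVertex k s} (R : ∀ i → Reach (suc t') (u i) (v i)) where
    open Reach

    path : ℕ → SPVertex k s
    path p i = rotate (clockwise (R i)) (p ⊓ steps (R i)) (u i)

    path-walk : ∀ {Ok} → (∀ p → p ≤ t' → Ok (path p)) → Ok v → Walk Ok (suc t') u v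
    path-walk ok okv = walk-along path t' ok (λ p i → adjacent-rotate-⊓ _ p _ (u i)) last okv
      where
        arrived : ∀ i → path (suc t') i ≡ v i
        arrived i = trans (cong (λ q → rotate (clockwise (R i)) q (u i)) (m≥n⇒m⊓n≡n (steps≤ (R i))))
                          (arrives (R i))
        last : SPAdj k s (path t') v
        last i = subst (CycleAdj (2 * s) (path t' i)) (arrived i) (adjacent-rotate-⊓ _ t' _ (u i))

  reach⇒copMove : ∀ {t' u v} → (∀ i → Reach (suc t') (u i) (v i)) → CopMove (suc t') u v
  reach⇒copMove {t'} R = suc t' , ≤-refl , path-walk R (λ _ _ → tt) tt

module CopStrategy (k s t' : ℕ) where
  open StrongProduct k s

  t : ℕ
  t = suc t'

  level : Cops (suc k) → SPVertex k s → Fin (suc k) → ℕ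
  level C r c = prefixLength (λ m → within? t (C c m) (r m))

  CanCapture : Cops (suc k) → SPVertex k s → Set
  CanCapture C r = ∃ λ c → level C r c ≡ k

  capture-at-level-k : ∀ {C r} → CanCapture C r → CopsWinFrom t C r
  capture-at-level-k {C} {r} (c , level≡k) = capture C r c (reach⇒copMove λ m →
    within⇒reach (prefixLength-holds _ m (subst (toℕ m <_) (sym level≡k) (Fin.toℕ<n m))))

  record Squeeze (C : Cops (suc k)) (r : SPVertex k s) : Set where
    field
      i j : Fin (suc k)
      i≢j : i ≢ j
      e : Fin k
      e≡level-i : toℕ e ≡ level C r i
      e≡level-j : toℕ e ≡ level C r j

    gap : ℕ
    gap = arc (C i e) (r e) + arc (r e) (C j e)

  capture-or-squeeze : ∀ C r → CanCapture C r ⊎ Squeeze C r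
  capture-or-squeeze C r with Fin.any? (λ c → level C r c ≟ k)
  ... | yes can = inj₁ can
  ... | no cannot with Fin.pigeonhole (n<1+n k) (λ c → fromℕ< (level<k c))
    where
      level<k : ∀ c → level C r c < k
      level<k c = ≤∧≢⇒< (prefixLength≤ _) (λ level≡k → cannot (c , level≡k))
  ...   | i , j , i<j , same = inj₂ (record
          { i = i ; j = j ; i≢j = Fin.<⇒≢ i<j ; e = fromℕ< _
          ; e≡level-i = Fin.toℕ-fromℕ< _
          ; e≡level-j = trans (cong toℕ same) (Fin.toℕ-fromℕ< _) })

  total : Cops (suc k) → SPVertex k s → ℕ
  total C r = sum (level C r)

  max-total : ℕ
  max-total = sum {suc k} (const k)

  total≤ : ∀ C r → total C r ≤ max-total
  total≤ C r = sum-mono-≤ {g = const k} (λ c → prefixLength≤ (λ m → within? t (C c m) (r m)))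

  potential : ∀ {C r} → Squeeze C r → ℕ × ℕ
  potential {C} {r} sq = max-total ∸ total C r , Squeeze.gap sq

  _⊏_ : ℕ × ℕ → ℕ × ℕ → Set
  _⊏_ = ×-Lex _≡_ _<_ _<_

  module Squeezing {C r} (sq : Squeeze C r) where
    open Squeeze sq

    -- Beyond their prefixes only the moves of i (clockwise) and j
    -- (counterclockwise) in coordinate e matter.
    chase : ∀ c m → Dec (toℕ m < level C r c) → Fin N
    chase c m (yes _) = r m
    chase c m (no _) = rotate (not (does (c Fin.≟ j))) t (C c m)

    C' : Cops (suc k)
    C' c m = chase c m (toℕ m <? level C r c)

    cops-move : ∀ c → CopMove t (C c) (C' c)
    cops-move c = reach⇒copMove λ m → chase-reach m (toℕ m <? level C r c)
      where
        chase-reach : ∀ m d → Reach t (C c m) (chase c m d)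
        chase-reach m (yes m<level) = within⇒reach (prefixLength-holds _ m m<level)
        chase-reach m (no _) = reach _ t ≤-refl refl

    chase-in-prefix : ∀ {c m} d → toℕ m < level C r c → chase c m d ≡ r m
    chase-in-prefix (yes _) _ = refl
    chase-in-prefix (no m≮level) m<level = ⊥-elim (m≮level m<level)

    chase-at-level : ∀ {c m} d → toℕ m ≡ level C r c →
                     chase c m d ≡ rotate (not (does (c Fin.≟ j))) t (C c m)
    chase-at-level (yes m<level) m≡level = ⊥-elim (<-irrefl m≡level m<level)
    chase-at-level (no _) _ = refl

    C'-i : C' i e ≡ rotate true t (C i e)
    C'-i = trans (chase-at-level (toℕ e <? level C r i) e≡level-i)
                 (cong (λ d → rotate (not d) t (C i e)) (dec-false (i Fin.≟ j) i≢j))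

    C'-j : C' j e ≡ rotate false t (C j e)
    C'-j = trans (chase-at-level (toℕ e <? level C r j) e≡level-j)
                 (cong (λ d → rotate (not d) t (C j e)) (dec-true (j Fin.≟ j) refl))

    module Response {r'} (robber : RobberMove t C' r r') where

      level-mono : ∀ c → level C r c ≤ level C' r' c
      level-mono c = prefixLength-mono _ _ λ m m<level →
        subst (λ x → Within t x (r' m)) (sym (chase-in-prefix (toℕ m <? level C r c) m<level))
              (reach⇒within (move⇒reach robber m))

      module _ (same-levels : ∀ c → level C' r' c ≡ level C r c) where

        squeeze-kept : Squeeze C' r'
        squeeze-kept = record
          { i = i ; j = j ; i≢j = i≢j ; e = e
          ; e≡level-i = trans e≡level-i (sym (same-levels i))
          ; e≡level-j = trans e≡level-j (sym (same-levels j)) }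

        gap-shrinks : Squeeze.gap squeeze-kept < gap
        gap-shrinks = begin-strict
          arc (C' i e) (r' e) + arc (r' e) (C' j e)
            ≡⟨ arc-sum-preserved (reach⇒within (move⇒reach robber e))
                                 (far-from-robber i e≡level-i) (far-from-robber j e≡level-j) ⟩
          arc (C' i e) x + arc x (C' j e)
            ≡⟨ cong₂ (λ a b → arc a x + arc x b) C'-i C'-j ⟩
          arc (rotate true t a) x + arc x (rotate false t b)
            <⟨ +-mono-<-≤ i-approaches j-approaches ⟩
          arc a x + arc x b ∎
          where
            open ≤-Reasoning
            a = C i e
            b = C j e
            x = r e
            far-from-robber : ∀ c → toℕ e ≡ level C r c → ¬ Within t (C' c e) (r' e)
            far-from-robber c e≡level = prefixLength-fails _ e (trans e≡level (sym (same-levels c)))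
            i-approaches : arc (rotate true t a) x < arc a x
            i-approaches = subst (arc (rotate true t a) x <_) (arc-rotate-cw-toward (<⇒≤ t<ax)) (m<n+m _ (s≤s z≤n))
              where t<ax = proj₁ (¬within⇒< (prefixLength-fails _ e e≡level-i))
            j-approaches : arc x (rotate false t b) ≤ arc x b
            j-approaches = subst (arc x (rotate false t b) ≤_) (arc-rotate-ccw-toward (<⇒≤ t<xb)) (m≤m+n _ t)
              where t<xb = proj₂ (¬within⇒< (prefixLength-fails _ e e≡level-j))

      progress : CanCapture C' r' ⊎ Σ (Squeeze C' r') λ sq' → potential sq' ⊏ potential sq
      progress with Fin.any? (λ c → level C r c <? level C' r' c)
      ... | yes (c , rises) with capture-or-squeeze C' r'
      ...   | inj₁ can = inj₁ can
      ...   | inj₂ sq' = inj₂ (sq' , inj₁ (∸-monoʳ-< (sum-mono-< level-mono c rises) (total≤ C' r')))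
      progress | no none =
        inj₂ (squeeze-kept same , inj₂ (cong (max-total ∸_) (sum-cong-≗ same) , gap-shrinks same))
        where
          same : ∀ c → level C' r' c ≡ level C r c
          same c = ≤-antisym (≮⇒≥ λ rises → none (c , rises)) (level-mono c)

  win : ∀ {C r} (sq : Squeeze C r) → Acc _⊏_ (potential sq) → CopsWinFrom t C r
  win sq (acc smaller) = move C' cops-move (inj₂ λ r' robber → respond (Response.progress robber))
    where
      open Squeezing sq
      respond : ∀ {r'} → CanCapture C' r' ⊎ Σ (Squeeze C' r') (λ sq' → potential sq' ⊏ potential sq) →
                CopsWinFrom t C' r'
      respond (inj₁ can) = capture-at-level-k can
      respond (inj₂ (sq' , decreased)) = win sq' (smaller decreased)

  k+1-cops-win : CopsWin t (suc k)
  k+1-cops-win = C₀ , λ r → inj₂ (start r)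
    where
      C₀ : Cops (suc k)
      C₀ _ _ = zero
      start : ∀ r → CopsWinFrom t C₀ r
      start r with capture-or-squeeze C₀ r
      ... | inj₁ can = capture-at-level-k can
      ... | inj₂ sq = win sq (×-wellFounded <-wellFounded <-wellFounded _)

module RobberStrategy (k s t' : ℕ) (t≤s : suc t' ≤ s) {m : ℕ}
                 (owner : Fin k → Fin m) (owner-onto : ∀ c → ∃ λ i → owner i ≡ c) where
  open StrongProduct k s
  open EvenCycle s

  t : ℕ
  t = suc t'

  shadow : Cops m → SPVertex k s
  shadow C i = antipode (C (owner i) i)

  unoccupied : ∀ {C : Cops m} {v} → (∀ i → C (owner i) i ≢ v i) → ¬ Occupied C v
  unoccupied apart (c , Cc≡v) with owner-onto c
  ... | i , refl = apart i (cong-app Cc≡v i)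

  escape : ∀ C → ¬ CopsWinFrom t C (shadow C)
  escape C (move C' moves outcome) = survive outcome
    where
      cop-reach : ∀ i → Reach t (C (owner i) i) (C' (owner i) i)
      cop-reach i = move⇒reach (moves (owner i)) i
      robber-walk : Walk (λ v → ¬ Occupied C' v) t (shadow C) (shadow C')
      robber-walk = path-walk (mirror ∘ cop-reach)
        (λ p _ → unoccupied λ i → mirror-never-meets t≤s (cop-reach i) p)
        (unoccupied λ i → rotate-≢-antipode true _ z≤n)
      survive : ¬ (Occupied C' (shadow C) ⊎ (∀ r' → RobberMove t C' (shadow C) r' → CopsWinFrom t C' r'))
      survive (inj₁ caught) = unoccupied (λ i → mirror-never-meets t≤s (cop-reach i) 0) caught
      survive (inj₂ next) = escape C' (next (shadow C') (t , ≤-refl , robber-walk))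

  robber-evades : ¬ CopsWin t m
  robber-evades (C₀ , win) with win (shadow C₀)
  ... | inj₁ caught = unoccupied (λ i → rotate-≢-antipode true _ z≤n) caught
  ... | inj₂ w = escape C₀ w

module _ (k s t' : ℕ) where
  open StrongProduct k s

  k-cops-lose : ∀ {m} → m ≤ k → suc t' ≤ s → ¬ CopsWin (suc t') m
  k-cops-lose {zero} _ _ = no-cops-lose (λ _ → zero)
  k-cops-lose {suc m} m≤k t≤s = RobberStrategy.robber-evades k s t' t≤s owner owner-onto
    where
      owner : Fin k → Fin (suc m)
      owner i = toℕ i mod suc m
      owner-onto : ∀ c → ∃ λ i → owner i ≡ c
      owner-onto c = inject≤ c m≤k , Fin.toℕ-injective (begin
        toℕ (toℕ (inject≤ c m≤k) mod suc m) ≡⟨ Fin.toℕ-fromℕ< _ ⟩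
        toℕ (inject≤ c m≤k) % suc m         ≡⟨ cong (_% suc m) (Fin.toℕ-inject≤ c m≤k) ⟩
        toℕ c % suc m                       ≡⟨ m<n⇒m%n≡m (Fin.toℕ<n c) ⟩
        toℕ c                               ∎)
        where open ≡-Reasoning

  one-cop-wins : s < suc t' → CopsWin (suc t') 1
  one-cop-wins s<t = C₀ , λ r → inj₂ (capture C₀ r zero (reach⇒copMove λ i →
    within⇒reach (within-mono s<t (EvenCycle.all-within s zero (r i)))))
    where
      C₀ : Cops 1
      C₀ _ _ = zero

lemma2p11 : (k s s' : ℕ) → 1 ≤ k → 1 ≤ s → 1 ≤ s' →
    (s' ≤ s → Game.CopNumberIs (SPAdj k s) s' (suc k)) ×
    (s < s' → Game.CopNumberIs (SPAdj k s) s' 1)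
lemma2p11 k s zero _ _ ()
lemma2p11 k s (suc t') _ _ _ =
  (λ t≤s → CopStrategy.k+1-cops-win k s t' , λ m m<1+k → k-cops-lose k s t' (s≤s⁻¹ m<1+k) t≤s) ,
  (λ s<t → one-cop-wins k s t' s<t , λ { zero _ → GameFacts.no-cops-lose (SPAdj k s) (λ _ → zero)
                                        ; (suc m) (s≤s ()) })
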